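{- Let $n,d,l,s$ be positive integers with $d(n-1)=ls$, and let $P=\{1,\dots,n\}$. Suppose that for each $i\in P$ there is a tactical configuration $(P\setminus\{i\},\mathcal{B}_i)$ with parameters $(n-1,s,l,d)$. Let $D_2$ be the directed graph with vertex set $V=\{(g,B): g\in P,\ B\in\mathcal{B}_g\}$ and an arc $(g,B)\to(g',B')$ if and only if either $g\in B'$, or $g=g'$ and $B\neq B'$. Then $D_2$ is a directed strongly regular graph with parameters \[(v,k,t,\lambda,\mu)=\big(ns,\ ls+s-1,\ ld+s-1,\ ld+s-2,\ (l+1)d\big).\]
   Context: A tactical configuration with parameters $(\bar v,\bar b,\bar k,\bar r)$ is a pair $(X,\mathcal{B})$ where $X$ is a set of $\bar v$ points and $\mathcal{B}$ is a collection of $\bar b$ subsets of $X$ (blocks), each of size $\bar k$, such that every point lies in exactly $\bar r$ blocks. A directed strongly regular graph with parameters $(v,k,t,\lambda,\mu)$ is a loopless directed graph on $v$ vertices with adjacency matrix $A$ satisfying $AJ=JA=kJ$ and $A^2=tI+\lambda A+\mu(J-I-A)$, where $I$ is the identity and $J$ the all-ones matrix. -}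

module Defs where

open import Data.Nat as ℕ using (ℕ; zero; suc; _∸_)
open import Data.Integer as ℤ using (ℤ; +_; _+_; _-_; _*_)
open import Data.Fin using (Fin; zero; suc; _≟_; remQuot)
open import Data.Fin.Subset using (Subset; _∈_; _∉_; _⊆_; ∣_∣)
open import Data.Fin.Subset.Properties using (_∈?_)
open import Data.Product using (_×_; _,_)
open import Data.Sum using (_⊎_)
open import Relation.Nullary using (Dec; yes; no; ¬_)
open import Relation.Nullary.Decidable using (⌊_⌋; _⊎-dec_; _×-dec_; ¬?)
open import Data.Bool using (Bool; true; false; if_then_else_)
open import Relation.Binary.PropositionalEquality using (_≡_)

Σℕ : ∀ {m} → (Fin m → ℕ) → ℕ
Σℕ {zero}  f = 0
Σℕ {suc m} f = f zero ℕ.+ Σℕ (λ i → f (suc i))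

Σℤ : ∀ {m} → (Fin m → ℤ) → ℤ
Σℤ {zero}  f = + 0
Σℤ {suc m} f = f zero + Σℤ (λ i → f (suc i))

count : ∀ {m} → (Fin m → Bool) → ℕ
count p = Σℕ (λ i → if p i then 1 else 0)

-- Tactical configurations.
-- Points: a subset X of Fin n. Blocks: an indexed family of b̄ subsets
-- of Fin n (indexed by Fin b̄, so the collection has exactly b̄ members).

record IsTacticalConfiguration {n b̄ : ℕ} (X : Subset n) (𝓑 : Fin b̄ → Subset n)
                               (v̄ k̄ r̄ : ℕ) : Set where
  field
    pointCount  : ∣ X ∣ ≡ v̄
    blocksInX   : ∀ β → 𝓑 β ⊆ X
    blockSize   : ∀ β → ∣ 𝓑 β ∣ ≡ k̄
    replication : ∀ x → x ∈ X → count (λ β → ⌊ x ∈? 𝓑 β ⌋) ≡ r̄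

Matrix : ℕ → Set
Matrix v = Fin v → Fin v → ℤ

_⊗_ : ∀ {v} → Matrix v → Matrix v → Matrix v
(A ⊗ B) i j = Σℤ (λ z → A i z * B z j)

I : ∀ {v} → Matrix v
I i j = if ⌊ i ≟ j ⌋ then + 1 else + 0

J : ∀ {v} → Matrix v
J i j = + 1

record IsDSRG (v k t λ' μ : ℕ) (A : Matrix v) : Set where
  field
    zeroOne  : ∀ i j → (A i j ≡ + 0) ⊎ (A i j ≡ + 1)
    loopless : ∀ i → A i i ≡ + 0
    AJ≡kJ    : ∀ i j → (A ⊗ J) i j ≡ + k * J i j
    JA≡kJ    : ∀ i j → (J ⊗ A) i j ≡ + k * J i j
    A²       : ∀ i j → (A ⊗ A) i j
                 ≡ + t * I i j + + λ' * A i j + + μ * (J i j - I i j - A i j)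

-- The digraph D₂.  Vertices are pairs (g , β) with g : Fin n a point and
-- β : Fin s the index of a block of 𝓑 g; they are enumerated as Fin (n * s)
-- via the standard bijection remQuot.

D₂-arc : ∀ {n s} → (𝓑 : Fin n → Fin s → Subset n) →
         Fin n × Fin s → Fin n × Fin s → Set
D₂-arc 𝓑 (g , B) (g' , B') = (g ∈ 𝓑 g' B') ⊎ ((g ≡ g') × ¬ (B ≡ B'))

D₂-arc? : ∀ {n s} (𝓑 : Fin n → Fin s → Subset n) x y → Dec (D₂-arc 𝓑 x y)
D₂-arc? 𝓑 (g , B) (g' , B') = (g ∈? 𝓑 g' B') ⊎-dec ((g ≟ g') ×-dec ¬? (B ≟ B'))

D₂-adj : ∀ {n s} → (Fin n → Fin s → Subset n) → Matrix (n ℕ.* s)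
D₂-adj {n} {s} 𝓑 x y =
  if ⌊ D₂-arc? 𝓑 (remQuot {n} s x) (remQuot {n} s y) ⌋ then + 1 else + 0

module Submission where

-- Write a vertex as (g , B) with B a block of 𝓑 g.  The arc indicator splits
-- into two disjoint parts,
--     arc (g , B) (h , C)  =  [g ∈ 𝓑 h C]  +  [g = h]·[B ≠ C],
-- an "incidence" arc and a "stay" arc (disjoint because g ∉ 𝓑 g C).  Row and
-- column sums follow from the replication number d and the block size l.
-- The number of 2-paths x → z → y expands into four sums (incidence/stay for
-- each of the two arcs), each of which is evaluated by the configuration
-- parameters; comparing the three cases  x = y,  x → y  and  x ↛ y  gives
-- t = ld+s-1, λ = ld+s-2 and μ = (l+1)d.

open import Defs
open import Data.Nat using (ℕ; _+_; _*_; _∸_; _≥_)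
open import Data.Fin using (Fin)
open import Data.Fin.Subset using (Subset; ∁; ⁅_⁆)
open import Relation.Binary.PropositionalEquality using (_≡_)

open import Data.Nat using (zero; suc)
import Data.Nat.Properties as ℕP
open import Data.Nat.Solver using (module +-*-Solver)
open import Data.Integer using (ℤ) renaming (+_ to pos)
import Data.Integer as ℤ
import Data.Integer.Properties as ℤP
open import Data.Fin using (zero; suc; _≟_; _↑ˡ_; _↑ʳ_; remQuot; combine)
import Data.Fin.Properties as FinP
open import Data.Fin.Subset using (_∈_; _∉_; ∣_∣)
open import Data.Fin.Subset.Properties
  using (_∈?_; x∈⁅x⁆; x∈∁p⇒x∉p; x∈⁅y⁆⇒x≡y; x∉p⇒x∈∁p)
open import Data.Vec using ([]; _∷_)
open import Data.Product as Product using (_×_; _,_; uncurry)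
open import Data.Sum as Sum using (_⊎_; inj₁; inj₂)
open import Data.Bool using (true; false; if_then_else_)
open import Data.Empty using (⊥; ⊥-elim)
open import Function using (_∘_)
open import Relation.Nullary using (Dec; yes; no; ¬_; does)
open import Relation.Nullary.Decidable using (⌊_⌋; ¬?; _⊎-dec_; _×-dec_; isYes≗does)
open import Relation.Binary.PropositionalEquality
  using (_≢_; refl; sym; trans; cong; cong₂; subst; module ≡-Reasoning)

open import Data.Integer.Tactic.RingSolver using (solve-∀)
open +-*-Solver using (solve; _:=_; _:+_; _:*_; con)
open import Algebra.Properties.CommutativeSemigroup ℕP.+-commutativeSemigroup
  using () renaming (interchange to +-interchange)

-- The indicator (0 or 1) of a decided proposition.  It is defined through
-- 'does' so that it computes on the decision procedure _≟_ of Fin; χ-isYes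
-- relates it to the form used in Defs.
χ : ∀ {p} {A : Set p} → Dec A → ℕ
χ a? = if does a? then 1 else 0

χ-isYes : ∀ {p} {A : Set p} (a? : Dec A) → χ a? ≡ (if ⌊ a? ⌋ then 1 else 0)
χ-isYes a? = cong (if_then 1 else 0) (sym (isYes≗does a?))

χ-pos : ∀ {p} {A : Set p} (a? : Dec A) → (if ⌊ a? ⌋ then pos 1 else pos 0) ≡ pos (χ a?)
χ-pos (yes _) = refl
χ-pos (no _)  = refl

χ-yes : ∀ {p} {A : Set p} (a? : Dec A) → A → χ a? ≡ 1
χ-yes (yes _) _ = refl
χ-yes (no ¬a) a = ⊥-elim (¬a a)

χ-no : ∀ {p} {A : Set p} (a? : Dec A) → ¬ A → χ a? ≡ 0
χ-no (yes a) ¬a = ⊥-elim (¬a a)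
χ-no (no _)  _  = refl

χ-01 : ∀ {p} {A : Set p} (a? : Dec A) → (χ a? ≡ 0) ⊎ (χ a? ≡ 1)
χ-01 (yes _) = inj₂ refl
χ-01 (no _)  = inj₁ refl

module _ {p q} {A : Set p} {B : Set q} where

  χ-⇔ : (A → B) → (B → A) → (a? : Dec A) (b? : Dec B) → χ a? ≡ χ b?
  χ-⇔ to from (yes a) b? = sym (χ-yes b? (to a))
  χ-⇔ to from (no ¬a) b? = sym (χ-no b? (¬a ∘ from))

  χ-⊎ : (A → B → ⊥) → (a? : Dec A) (b? : Dec B) → χ (a? ⊎-dec b?) ≡ χ a? + χ b?
  χ-⊎ disj (yes a) (yes b) = ⊥-elim (disj a b)
  χ-⊎ disj (yes _) (no _)  = refl
  χ-⊎ disj (no _)  (yes _) = refl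
  χ-⊎ disj (no _)  (no _)  = refl

  χ-× : (a? : Dec A) (b? : Dec B) → χ (a? ×-dec b?) ≡ χ a? * χ b?
  χ-× (yes _) (yes _) = refl
  χ-× (yes _) (no _)  = refl
  χ-× (no _)  _       = refl

δ δᶜ : ∀ {m} → Fin m → Fin m → ℕ
δ  a b = χ (a ≟ b)
δᶜ a b = χ (¬? (a ≟ b))

module _ {m : ℕ} where

  δ-sym : (a b : Fin m) → δ a b ≡ δ b a
  δ-sym a b = χ-⇔ sym sym (a ≟ b) (b ≟ a)

  δᶜ-sym : (a b : Fin m) → δᶜ a b ≡ δᶜ b a
  δᶜ-sym a b = χ-⇔ (_∘ sym) (_∘ sym) (¬? (a ≟ b)) (¬? (b ≟ a))

  δ-refl : (a : Fin m) → δ a a ≡ 1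
  δ-refl a = χ-yes (a ≟ a) refl

  δ-≢ : {a b : Fin m} → a ≢ b → δ a b ≡ 0
  δ-≢ {a} {b} a≢b = χ-no (a ≟ b) a≢b

  δᶜ-refl : (a : Fin m) → δᶜ a a ≡ 0
  δᶜ-refl a = χ-no (¬? (a ≟ a)) (λ a≢a → a≢a refl)

  δᶜ-≢ : {a b : Fin m} → a ≢ b → δᶜ a b ≡ 1
  δᶜ-≢ {a} {b} a≢b = χ-yes (¬? (a ≟ b)) a≢b

  δᶜ+δ : (i a : Fin m) → δᶜ i a + δ i a ≡ 1
  δᶜ+δ i a with i ≟ a
  ... | yes _ = refl
  ... | no _  = refl

  δᶜ-pair-partition : (B B' C : Fin m) →
    δᶜ B C * δᶜ C B' + δ C B + δ C B' * δᶜ B B' ≡ 1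
  δᶜ-pair-partition B B' C with C ≟ B | C ≟ B'
  ... | yes refl | yes refl rewrite δᶜ-refl C = refl
  ... | yes refl | no _     rewrite δᶜ-refl C = refl
  ... | no C≢B   | yes refl rewrite δᶜ-≢ (C≢B ∘ sym) = refl
  ... | no C≢B   | no _     rewrite δᶜ-≢ (C≢B ∘ sym) = refl

Σ-cong : ∀ {m} {f g : Fin m → ℕ} → (∀ i → f i ≡ g i) → Σℕ f ≡ Σℕ g
Σ-cong {zero}  eq = refl
Σ-cong {suc m} eq = cong₂ _+_ (eq zero) (Σ-cong (eq ∘ suc))

Σ-+ : ∀ {m} (f g : Fin m → ℕ) → Σℕ (λ i → f i + g i) ≡ Σℕ f + Σℕ g
Σ-+ {zero}  f g = refl
Σ-+ {suc m} f g = begin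
  (f zero + g zero) + Σℕ (λ i → f (suc i) + g (suc i))
    ≡⟨ cong ((f zero + g zero) +_) (Σ-+ (f ∘ suc) (g ∘ suc)) ⟩
  (f zero + g zero) + (Σℕ (f ∘ suc) + Σℕ (g ∘ suc))
    ≡⟨ +-interchange (f zero) (g zero) _ _ ⟩
  (f zero + Σℕ (f ∘ suc)) + (g zero + Σℕ (g ∘ suc)) ∎
  where open ≡-Reasoning

Σ-+₄ : ∀ {m} (f g h k : Fin m → ℕ) →
       Σℕ (λ i → f i + g i + h i + k i) ≡ Σℕ f + Σℕ g + Σℕ h + Σℕ k
Σ-+₄ f g h k = trans (Σ-+ (λ i → f i + g i + h i) k)
  (cong (_+ Σℕ k) (trans (Σ-+ (λ i → f i + g i) h) (cong (_+ Σℕ h) (Σ-+ f g))))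

Σ-*ˡ : ∀ {m} (c : ℕ) (f : Fin m → ℕ) → Σℕ (λ i → c * f i) ≡ c * Σℕ f
Σ-*ˡ {zero}  c f = sym (ℕP.*-zeroʳ c)
Σ-*ˡ {suc m} c f = trans (cong (c * f zero +_) (Σ-*ˡ c (f ∘ suc)))
                         (sym (ℕP.*-distribˡ-+ c (f zero) _))

Σ-*ʳ : ∀ {m} (c : ℕ) (f : Fin m → ℕ) → Σℕ (λ i → f i * c) ≡ Σℕ f * c
Σ-*ʳ c f = trans (Σ-cong (λ i → ℕP.*-comm (f i) c))
                 (trans (Σ-*ˡ c f) (ℕP.*-comm c (Σℕ f)))

Σ-const : ∀ m c → Σℕ {m} (λ _ → c) ≡ m * c
Σ-const zero    c = refl
Σ-const (suc m) c = cong (c +_) (Σ-const m c)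

Σ-0 : ∀ m → Σℕ {m} (λ _ → 0) ≡ 0
Σ-0 m = trans (Σ-const m 0) (ℕP.*-zeroʳ m)

Σ-δ : ∀ {m} (a : Fin m) (f : Fin m → ℕ) → Σℕ (λ i → δ i a * f i) ≡ f a
Σ-δ {suc m} zero    f = trans (cong (f zero + 0 +_) (Σ-0 m))
                              (trans (ℕP.+-identityʳ _) (ℕP.+-identityʳ _))
Σ-δ {suc m} (suc a) f = Σ-δ a (λ i → f (suc i))

Σ-δ′ : ∀ {m} (a : Fin m) (f : Fin m → ℕ) → Σℕ (λ i → δ a i * f i) ≡ f a
Σ-δ′ a f = trans (Σ-cong (λ i → cong (_* f i) (δ-sym a i))) (Σ-δ a f)

Σ-split : ∀ {m} (a : Fin m) (f : Fin m → ℕ) → Σℕ (λ i → δᶜ i a * f i) + f a ≡ Σℕ f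
Σ-split a f = begin
  Σℕ (λ i → δᶜ i a * f i) + f a
    ≡⟨ cong (Σℕ (λ i → δᶜ i a * f i) +_) (sym (Σ-δ a f)) ⟩
  Σℕ (λ i → δᶜ i a * f i) + Σℕ (λ i → δ i a * f i)
    ≡⟨ sym (Σ-+ (λ i → δᶜ i a * f i) (λ i → δ i a * f i)) ⟩
  Σℕ (λ i → δᶜ i a * f i + δ i a * f i)
    ≡⟨ Σ-cong (λ i → trans (sym (ℕP.*-distribʳ-+ (f i) (δᶜ i a) (δ i a)))
                           (trans (cong (_* f i) (δᶜ+δ i a)) (ℕP.*-identityˡ (f i)))) ⟩
  Σℕ f ∎
  where open ≡-Reasoning

Σ-1 : ∀ m → Σℕ {m} (λ _ → 1) ≡ m
Σ-1 m = trans (Σ-const m 1) (ℕP.*-identityʳ m)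

Σ-others : ∀ {m} (a : Fin m) → Σℕ (λ i → δᶜ a i) + 1 ≡ m
Σ-others {m} a = begin
  Σℕ (λ i → δᶜ a i) + 1     ≡⟨ cong (_+ 1) (Σ-cong (λ i → trans (δᶜ-sym a i) (sym (ℕP.*-identityʳ _)))) ⟩
  Σℕ (λ i → δᶜ i a * 1) + 1 ≡⟨ Σ-split a (λ _ → 1) ⟩
  Σℕ {m} (λ _ → 1)          ≡⟨ Σ-1 m ⟩
  m                         ∎
  where open ≡-Reasoning

Σ-others₂ : ∀ {m} (B B' : Fin m) → Σℕ (λ C → δᶜ B C * δᶜ C B') + 1 + δᶜ B B' ≡ m
Σ-others₂ {m} B B' = begin
  Σℕ (λ C → δᶜ B C * δᶜ C B') + 1 + δᶜ B B'
    ≡⟨ cong₂ (λ x y → Σℕ (λ C → δᶜ B C * δᶜ C B') + x + y)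
             (sym (trans (Σ-cong (λ C → sym (ℕP.*-identityʳ (δ C B)))) (Σ-δ B (λ _ → 1))))
             (sym (Σ-δ B' (λ _ → δᶜ B B'))) ⟩
  Σℕ (λ C → δᶜ B C * δᶜ C B') + Σℕ (λ C → δ C B) + Σℕ (λ C → δ C B' * δᶜ B B')
    ≡⟨ sym (trans (Σ-+ (λ C → δᶜ B C * δᶜ C B' + δ C B) (λ C → δ C B' * δᶜ B B'))
                  (cong (_+ Σℕ (λ C → δ C B' * δᶜ B B')) (Σ-+ (λ C → δᶜ B C * δᶜ C B') (λ C → δ C B)))) ⟩
  Σℕ (λ C → δᶜ B C * δᶜ C B' + δ C B + δ C B' * δᶜ B B')
    ≡⟨ Σ-cong (δᶜ-pair-partition B B') ⟩
  Σℕ {m} (λ _ → 1)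
    ≡⟨ Σ-1 m ⟩
  m ∎
  where open ≡-Reasoning

Σ-∈ : ∀ {m} (p : Subset m) → Σℕ (λ h → χ (h ∈? p)) ≡ ∣ p ∣
Σ-∈ []          = refl
Σ-∈ (true ∷ p)  = cong suc (Σ-∈ p)
Σ-∈ (false ∷ p) = Σ-∈ p

Σ² : ∀ {m s} → (Fin m × Fin s → ℕ) → ℕ
Σ² F = Σℕ (λ g → Σℕ (λ β → F (g , β)))

Σ-++ : ∀ a b (f : Fin (a + b) → ℕ) →
       Σℕ f ≡ Σℕ (λ i → f (i ↑ˡ b)) + Σℕ (λ j → f (a ↑ʳ j))
Σ-++ zero    b f = refl
Σ-++ (suc a) b f = trans (cong (f zero +_) (Σ-++ a b (f ∘ suc)))
                         (sym (ℕP.+-assoc (f zero) _ _))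

remQuot-↑ʳ : ∀ m s (j : Fin (m * s)) →
             remQuot {suc m} s (s ↑ʳ j) ≡ Product.map₁ suc (remQuot {m} s j)
remQuot-↑ʳ m s j rewrite FinP.splitAt-↑ʳ s (m * s) j = refl

Σ-remQuot : ∀ m s (F : Fin m × Fin s → ℕ) → Σℕ (λ x → F (remQuot {m} s x)) ≡ Σ² F
Σ-remQuot zero    s F = refl
Σ-remQuot (suc m) s F = trans (Σ-++ s (m * s) _) (cong₂ _+_
  (Σ-cong (λ β → cong F (FinP.remQuot-combine {suc m} {s} zero β)))
  (trans (Σ-cong (λ j → cong F (remQuot-↑ʳ m s j)))
         (Σ-remQuot m s (F ∘ Product.map₁ suc))))

remQuot-injective : ∀ m s (x y : Fin (m * s)) → remQuot {m} s x ≡ remQuot s y → x ≡ y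
remQuot-injective m s x y eq = trans (sym (FinP.combine-remQuot {m} s x))
  (trans (cong (uncurry combine) eq) (FinP.combine-remQuot {m} s y))

Σℤ-cong : ∀ {m} {f g : Fin m → ℤ} → (∀ i → f i ≡ g i) → Σℤ f ≡ Σℤ g
Σℤ-cong {zero}  eq = refl
Σℤ-cong {suc m} eq = cong₂ ℤ._+_ (eq zero) (Σℤ-cong (eq ∘ suc))

Σℤ-pos : ∀ {m} (f : Fin m → ℕ) → Σℤ (λ i → pos (f i)) ≡ pos (Σℕ f)
Σℤ-pos {zero}  f = refl
Σℤ-pos {suc m} f = trans (cong (ℤ._+_ (pos (f zero))) (Σℤ-pos (f ∘ suc)))
                       (sym (ℤP.pos-+ (f zero) _))

dsrg-rhs-diag : ∀ (t λ' μ : ℤ) → t ℤ.* pos 1 ℤ.+ λ' ℤ.* pos 0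
                  ℤ.+ μ ℤ.* (pos 1 ℤ.- pos 1 ℤ.- pos 0) ≡ t
dsrg-rhs-diag = solve-∀

dsrg-rhs-arc : ∀ (t λ' μ : ℤ) → t ℤ.* pos 0 ℤ.+ λ' ℤ.* pos 1
                 ℤ.+ μ ℤ.* (pos 1 ℤ.- pos 0 ℤ.- pos 1) ≡ λ'
dsrg-rhs-arc = solve-∀

dsrg-rhs-nonarc : ∀ (t λ' μ : ℤ) → t ℤ.* pos 0 ℤ.+ λ' ℤ.* pos 0
                    ℤ.+ μ ℤ.* (pos 1 ℤ.- pos 0 ℤ.- pos 0) ≡ μ
dsrg-rhs-nonarc = solve-∀

I-refl : ∀ {v} (i : Fin v) → I i i ≡ pos 1
I-refl i with i ≟ i
... | yes _   = refl
... | no i≢i = ⊥-elim (i≢i refl)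

I-≢ : ∀ {v} {i j : Fin v} → i ≢ j → I i j ≡ pos 0
I-≢ {i = i} {j} i≢j with i ≟ j
... | yes i≡j = ⊥-elim (i≢j i≡j)
... | no _    = refl

module _ {v : ℕ} (A : Matrix v) (a : Fin v → Fin v → ℕ)
         (A≡a : ∀ i j → A i j ≡ pos (a i j)) where

  twoPaths : Fin v → Fin v → ℕ
  twoPaths i j = Σℕ (λ z → a i z * a z j)

  A²≡twoPaths : ∀ i j → (A ⊗ A) i j ≡ pos (twoPaths i j)
  A²≡twoPaths i j = trans
    (Σℤ-cong (λ z → trans (cong₂ ℤ._*_ (A≡a i z) (A≡a z j)) (sym (ℤP.pos-* (a i z) (a z j)))))
    (Σℤ-pos (λ z → a i z * a z j))

  dsrg-criterion : ∀ k t λ' μ →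
    (∀ i j → (a i j ≡ 0) ⊎ (a i j ≡ 1)) →
    (∀ i → a i i ≡ 0) →
    (∀ i → Σℕ (a i) ≡ k) →
    (∀ j → Σℕ (λ i → a i j) ≡ k) →
    (∀ i → twoPaths i i ≡ t) →
    (∀ i j → i ≢ j → a i j ≡ 1 → twoPaths i j ≡ λ') →
    (∀ i j → i ≢ j → a i j ≡ 0 → twoPaths i j ≡ μ) →
    IsDSRG v k t λ' μ A
  dsrg-criterion k t λ' μ zero-one loopless row col diag arc nonarc = record
    { zeroOne  = λ i j → Sum.map (entry i j) (entry i j) (zero-one i j)
    ; loopless = λ i → entry i i (loopless i)
    ; AJ≡kJ    = λ i j → line-sum (λ z → trans (ℤP.*-identityʳ (A i z)) (A≡a i z)) (row i)
    ; JA≡kJ    = λ i j → line-sum (λ z → trans (ℤP.*-identityˡ (A z j)) (A≡a z j)) (col j)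
    ; A²       = square
    }
    where
    entry : ∀ i j {x} → a i j ≡ x → A i j ≡ pos x
    entry i j eq = trans (A≡a i j) (cong pos eq)

    line-sum : {f : Fin v → ℤ} {g : Fin v → ℕ} → (∀ z → f z ≡ pos (g z)) →
               Σℕ g ≡ k → Σℤ f ≡ pos k ℤ.* pos 1
    line-sum {g = g} f≡g sum≡k = trans (Σℤ-cong f≡g)
      (trans (Σℤ-pos g) (trans (cong pos sum≡k) (sym (ℤP.*-identityʳ (pos k)))))

    rhs : ℤ → ℤ → ℤ
    rhs x y = pos t ℤ.* x ℤ.+ pos λ' ℤ.* y ℤ.+ pos μ ℤ.* (pos 1 ℤ.- x ℤ.- y)

    off-diagonal : ∀ i j → i ≢ j → (a i j ≡ 0) ⊎ (a i j ≡ 1) → (A ⊗ A) i j ≡ rhs (I i j) (A i j)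
    off-diagonal i j i≢j (inj₂ a≡1) = trans (A²≡twoPaths i j) (trans (cong pos (arc i j i≢j a≡1))
      (sym (trans (cong₂ rhs (I-≢ i≢j) (entry i j a≡1)) (dsrg-rhs-arc (pos t) (pos λ') (pos μ)))))
    off-diagonal i j i≢j (inj₁ a≡0) = trans (A²≡twoPaths i j) (trans (cong pos (nonarc i j i≢j a≡0))
      (sym (trans (cong₂ rhs (I-≢ i≢j) (entry i j a≡0)) (dsrg-rhs-nonarc (pos t) (pos λ') (pos μ)))))

    diagonal : ∀ i → (A ⊗ A) i i ≡ rhs (I i i) (A i i)
    diagonal i = trans (A²≡twoPaths i i) (trans (cong pos (diag i))
      (sym (trans (cong₂ rhs (I-refl i) (entry i i (loopless i))) (dsrg-rhs-diag (pos t) (pos λ') (pos μ)))))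

    square : ∀ i j → (A ⊗ A) i j ≡ rhs (I i j) (A i j)
    square i j = by-cases (i ≟ j)
      where
      by-cases : Dec (i ≡ j) → (A ⊗ A) i j ≡ rhs (I i j) (A i j)
      by-cases (yes i≡j) = subst (λ j → (A ⊗ A) i j ≡ rhs (I i j) (A i j)) i≡j (diagonal i)
      by-cases (no i≢j)  = off-diagonal i j i≢j (zero-one i j)

+-to-∸ : ∀ {x k y} → x + k ≡ y → x ≡ y ∸ k
+-to-∸ {x} {k} eq = trans (sym (ℕP.m+n∸n≡m x k)) (cong (_∸ k) eq)

+-cancel-0 : ∀ {x y z} → x + y ≡ z → y ≡ 0 → x ≡ z
+-cancel-0 {x} eq refl = trans (sym (ℕP.+-identityʳ x)) eq

module D₂Counting (n d l s : ℕ) (𝓑 : Fin n → Fin s → Subset n)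
  (tc : ∀ i → IsTacticalConfiguration (∁ ⁅ i ⁆) (𝓑 i) (n ∸ 1) l d) where
  open IsTacticalConfiguration

  Vertex : Set
  Vertex = Fin n × Fin s

  inc : Fin n → Fin n → Fin s → ℕ
  inc g h C = χ (g ∈? 𝓑 h C)

  -- The blocks of 𝓑 g live on P ∖ {g}.
  ∉-own-block : ∀ g C → g ∉ 𝓑 g C
  ∉-own-block g C g∈ = x∈∁p⇒x∉p (blocksInX (tc g) C g∈) (x∈⁅x⁆ g)

  inc-own : ∀ g C → inc g g C ≡ 0
  inc-own g C = χ-no (g ∈? 𝓑 g C) (∉-own-block g C)

  replicates : ∀ g h → Σℕ (inc g h) ≡ d * δᶜ g h
  replicates g h with g ≟ h
  ... | yes refl = trans (Σ-cong (inc-own g)) (trans (Σ-0 s) (sym (ℕP.*-zeroʳ d)))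
  ... | no g≢h  = trans (Σ-cong (λ C → χ-isYes (g ∈? 𝓑 h C)))
    (trans (replication (tc h) g (x∉p⇒x∈∁p (g≢h ∘ x∈⁅y⁆⇒x≡y h))) (sym (ℕP.*-identityʳ d)))

  block-size : ∀ g' B' → Σℕ (λ h → inc h g' B') ≡ l
  block-size g' B' = trans (Σ-∈ (𝓑 g' B')) (blockSize (tc g') B')

  arc : Vertex → Vertex → ℕ
  arc x y = χ (D₂-arc? 𝓑 x y)

  arc-split : ∀ g B h C → arc (g , B) (h , C) ≡ inc g h C + δ g h * δᶜ B C
  arc-split g B h C =
    trans (χ-⊎ disjoint (g ∈? 𝓑 h C) ((g ≟ h) ×-dec ¬? (B ≟ C)))
          (cong (inc g h C +_) (χ-× (g ≟ h) (¬? (B ≟ C))))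
    where
    disjoint : g ∈ 𝓑 h C → (g ≡ h) × (B ≢ C) → ⊥
    disjoint g∈ (refl , _) = ∉-own-block g C g∈

  arc-same-point : ∀ g B B' → arc (g , B) (g , B') ≡ δᶜ B B'
  arc-same-point g B B' = trans (arc-split g B g B')
    (trans (cong₂ (λ x y → x + y * δᶜ B B') (inc-own g B') (δ-refl g)) (ℕP.+-identityʳ _))

  arc-other-point : ∀ {g g'} B B' → g ≢ g' → arc (g , B) (g' , B') ≡ inc g g' B'
  arc-other-point {g} {g'} B B' g≢g' = trans (arc-split g B g' B')
    (trans (cong (λ y → inc g g' B' + y * δᶜ B B') (δ-≢ g≢g')) (ℕP.+-identityʳ _))

  arc-loop : ∀ x → arc x x ≡ 0
  arc-loop (g , B) = trans (arc-same-point g B B) (δᶜ-refl B)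

  -- Out-degree: d(n - 1) = ls incidence arcs (d blocks through g at each of
  -- the n - 1 other points) and s - 1 stay arcs.
  out-degree : d * (n ∸ 1) ≡ l * s → ∀ x → Σ² (arc x) ≡ l * s + s ∸ 1
  out-degree hyp (g , B) = +-to-∸ (begin
    Σ² (arc (g , B)) + 1
      ≡⟨ cong (_+ 1) (Σ-cong out-of-point) ⟩
    Σℕ (λ h → Σℕ (inc g h) + δ g h * Σℕ (δᶜ B)) + 1
      ≡⟨ cong (_+ 1) (Σ-+ (λ h → Σℕ (inc g h)) (λ h → δ g h * Σℕ (δᶜ B))) ⟩
    Σℕ (λ h → Σℕ (inc g h)) + Σℕ (λ h → δ g h * Σℕ (δᶜ B)) + 1
      ≡⟨ cong₂ (λ x y → x + y + 1) (trans (Σ-cong (replicates g)) (Σ-*ˡ d (δᶜ g)))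
                                    (Σ-δ′ g (λ _ → Σℕ (δᶜ B))) ⟩
    d * Σℕ (δᶜ g) + Σℕ (δᶜ B) + 1
      ≡⟨ ℕP.+-assoc (d * Σℕ (δᶜ g)) (Σℕ (δᶜ B)) 1 ⟩
    d * Σℕ (δᶜ g) + (Σℕ (δᶜ B) + 1)
      ≡⟨ cong₂ _+_ (trans (cong (d *_) (+-to-∸ (Σ-others g))) hyp) (Σ-others B) ⟩
    l * s + s ∎)
    where
    open ≡-Reasoning
    out-of-point : ∀ h → Σℕ (λ C → arc (g , B) (h , C)) ≡ Σℕ (inc g h) + δ g h * Σℕ (δᶜ B)
    out-of-point h = trans (Σ-cong (arc-split g B h))
      (trans (Σ-+ (inc g h) (λ C → δ g h * δᶜ B C)) (cong (Σℕ (inc g h) +_) (Σ-*ˡ (δ g h) (δᶜ B))))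

  -- In-degree: s incidence arcs from each of the l points of the block, and
  -- s - 1 stay arcs.
  in-degree : ∀ y → Σ² (λ x → arc x y) ≡ l * s + s ∸ 1
  in-degree (g' , B') = +-to-∸ (begin
    Σ² (λ x → arc x (g' , B')) + 1
      ≡⟨ cong (_+ 1) (Σ-cong into-point) ⟩
    Σℕ (λ h → s * inc h g' B' + δ h g' * Σℕ (δᶜ B')) + 1
      ≡⟨ cong (_+ 1) (Σ-+ (λ h → s * inc h g' B') (λ h → δ h g' * Σℕ (δᶜ B'))) ⟩
    Σℕ (λ h → s * inc h g' B') + Σℕ (λ h → δ h g' * Σℕ (δᶜ B')) + 1
      ≡⟨ cong₂ (λ x y → x + y + 1) (trans (Σ-*ˡ s (λ h → inc h g' B')) (cong (s *_) (block-size g' B')))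
                                    (Σ-δ g' (λ _ → Σℕ (δᶜ B'))) ⟩
    s * l + Σℕ (δᶜ B') + 1
      ≡⟨ ℕP.+-assoc (s * l) (Σℕ (δᶜ B')) 1 ⟩
    s * l + (Σℕ (δᶜ B') + 1)
      ≡⟨ cong₂ _+_ (ℕP.*-comm s l) (Σ-others B') ⟩
    l * s + s ∎)
    where
    open ≡-Reasoning
    into-point : ∀ h → Σℕ (λ C → arc (h , C) (g' , B')) ≡ s * inc h g' B' + δ h g' * Σℕ (δᶜ B')
    into-point h = trans (Σ-cong (λ C → arc-split h C g' B'))
      (trans (Σ-+ (λ _ → inc h g' B') (λ C → δ h g' * δᶜ C B'))
        (cong₂ _+_ (Σ-const s (inc h g' B'))
                   (trans (Σ-*ˡ (δ h g') (λ C → δᶜ C B')) (cong (δ h g' *_) (Σ-cong (λ C → δᶜ-sym C B'))))))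

  paths : Vertex → Vertex → ℕ
  paths x y = Σ² (λ z → arc x z * arc z y)

  module TwoPaths (g : Fin n) (B : Fin s) (g' : Fin n) (B' : Fin s) where

    e : ℕ
    e = inc g g' B'

    incInc incStay stayInc stayStay : Fin n → Fin s → ℕ
    incInc   h C = inc g h C * inc h g' B'
    incStay  h C = δ h g' * (δᶜ C B' * inc g h C)
    stayInc  h C = δ g h * (δᶜ B C * inc h g' B')
    stayStay h C = δ g h * (δ h g' * (δᶜ B C * δᶜ C B'))

    #incInc #incStay #stayInc #stayStay : ℕ
    #incInc   = Σℕ (λ h → Σℕ (incInc h))
    #incStay  = Σℕ (λ h → Σℕ (incStay h))
    #stayInc  = Σℕ (λ h → Σℕ (stayInc h))
    #stayStay = Σℕ (λ h → Σℕ (stayStay h))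

    paths-split : paths (g , B) (g' , B') ≡ #incInc + #incStay + #stayInc + #stayStay
    paths-split = trans (Σ-cong (λ h → trans (Σ-cong (expand h)) (Σ-+₄ (incInc h) (incStay h) (stayInc h) (stayStay h))))
                        (Σ-+₄ (λ h → Σℕ (incInc h)) (λ h → Σℕ (incStay h)) (λ h → Σℕ (stayInc h)) (λ h → Σℕ (stayStay h)))
      where
      distribute : ∀ a x y b u v → (a + x * y) * (b + u * v) ≡ a * b + u * (v * a) + x * (y * b) + x * (u * (y * v))
      distribute = solve 6 (λ a x y b u v → (a :+ x :* y) :* (b :+ u :* v)
                                := a :* b :+ u :* (v :* a) :+ x :* (y :* b) :+ x :* (u :* (y :* v))) refl
      expand : ∀ h C → arc (g , B) (h , C) * arc (h , C) (g' , B') ≡ incInc h C + incStay h C + stayInc h C + stayStay h C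
      expand h C = trans (cong₂ _*_ (arc-split g B h C) (arc-split h C g' B'))
                         (distribute (inc g h C) (δ g h) (δᶜ B C) (inc h g' B') (δ h g') (δᶜ C B'))

    -- Incidence-incidence paths: for each of the points h ≠ g of the block B',
    -- the d blocks of 𝓑 h through g.
    #incInc-count : #incInc + d * e ≡ d * l
    #incInc-count = begin
      #incInc + d * e
        ≡⟨ cong (_+ d * e) (Σ-cong via) ⟩
      Σℕ (λ h → d * (δᶜ h g * inc h g' B')) + d * e
        ≡⟨ cong (_+ d * e) (Σ-*ˡ d (λ h → δᶜ h g * inc h g' B')) ⟩
      d * Σℕ (λ h → δᶜ h g * inc h g' B') + d * e
        ≡⟨ sym (ℕP.*-distribˡ-+ d _ e) ⟩
      d * (Σℕ (λ h → δᶜ h g * inc h g' B') + e)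
        ≡⟨ cong (d *_) (trans (Σ-split g (λ h → inc h g' B')) (block-size g' B')) ⟩
      d * l ∎
      where
      open ≡-Reasoning
      via : ∀ h → Σℕ (incInc h) ≡ d * (δᶜ h g * inc h g' B')
      via h = trans (Σ-*ʳ (inc h g' B') (inc g h))
        (trans (cong (_* inc h g' B') (replicates g h))
          (trans (ℕP.*-assoc d (δᶜ g h) (inc h g' B')) (cong (λ x → d * (x * inc h g' B')) (δᶜ-sym g h))))

    -- Incidence-stay paths end at a block C ≠ B' of 𝓑 g' through g.
    #incStay-count : #incStay + e ≡ d * δᶜ g g'
    #incStay-count = begin
      #incStay + e
        ≡⟨ cong (_+ e) (Σ-cong (λ h → Σ-*ˡ (δ h g') (λ C → δᶜ C B' * inc g h C))) ⟩
      Σℕ (λ h → δ h g' * Σℕ (λ C → δᶜ C B' * inc g h C)) + e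
        ≡⟨ cong (_+ e) (Σ-δ g' (λ h → Σℕ (λ C → δᶜ C B' * inc g h C))) ⟩
      Σℕ (λ C → δᶜ C B' * inc g g' C) + e
        ≡⟨ Σ-split B' (inc g g') ⟩
      Σℕ (inc g g')
        ≡⟨ replicates g g' ⟩
      d * δᶜ g g' ∎
      where open ≡-Reasoning

    -- Stay-incidence paths pass through (g , C), C ≠ B, and need g ∈ 𝓑 g' B'.
    #stayInc-count : #stayInc ≡ Σℕ (δᶜ B) * e
    #stayInc-count = trans
      (Σ-cong (λ h → trans (Σ-*ˡ (δ g h) (λ C → δᶜ B C * inc h g' B'))
                           (cong (δ g h *_) (Σ-*ʳ (inc h g' B') (δᶜ B)))))
      (Σ-δ′ g (λ h → Σℕ (δᶜ B) * inc h g' B'))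

    -- Stay-stay paths exist only when g = g', through the blocks C ∉ {B, B'}.
    #stayStay-count : #stayStay ≡ δ g g' * Σℕ (λ C → δᶜ B C * δᶜ C B')
    #stayStay-count = trans
      (Σ-cong (λ h → trans (Σ-*ˡ (δ g h) (λ C → δ h g' * (δᶜ B C * δᶜ C B')))
                           (cong (δ g h *_) (Σ-*ˡ (δ h g') (λ C → δᶜ B C * δᶜ C B')))))
      (Σ-δ′ g (λ h → δ h g' * Σℕ (λ C → δᶜ B C * δᶜ C B')))

    #incInc-off : e ≡ 0 → #incInc ≡ d * l
    #incInc-off e≡0 = +-cancel-0 #incInc-count (trans (cong (d *_) e≡0) (ℕP.*-zeroʳ d))

    #stayInc-off : e ≡ 0 → #stayInc ≡ 0
    #stayInc-off e≡0 = trans #stayInc-count (trans (cong (Σℕ (δᶜ B) *_) e≡0) (ℕP.*-zeroʳ (Σℕ (δᶜ B))))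

    #stayStay-apart : g ≢ g' → #stayStay ≡ 0
    #stayStay-apart g≢g' = trans #stayStay-count (cong (_* Σℕ (λ C → δᶜ B C * δᶜ C B')) (δ-≢ g≢g'))

  -- Two vertices on the same point g: d·l incidence-incidence paths and the
  -- stay-stay paths through the blocks C ∉ {B, B'}.
  paths-same-point : ∀ g B B' → paths (g , B) (g , B') + (1 + δᶜ B B') ≡ l * d + s
  paths-same-point g B B' = begin
    paths (g , B) (g , B') + (1 + δᶜ B B')
      ≡⟨ cong (_+ (1 + δᶜ B B')) paths-split ⟩
    #incInc + #incStay + #stayInc + #stayStay + (1 + δᶜ B B')
      ≡⟨ cong (_+ (1 + δᶜ B B')) (cong₂ _+_ (cong₂ _+_ (cong₂ _+_ (#incInc-off e≡0) #incStay≡0)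
                                                        (#stayInc-off e≡0)) #stayStay≡W) ⟩
    d * l + 0 + 0 + W + (1 + δᶜ B B')
      ≡⟨ solve 4 (λ d l W x → d :* l :+ con 0 :+ con 0 :+ W :+ (con 1 :+ x)
                              := l :* d :+ (W :+ con 1 :+ x)) refl d l W (δᶜ B B') ⟩
    l * d + (W + 1 + δᶜ B B')
      ≡⟨ cong (l * d +_) (Σ-others₂ B B') ⟩
    l * d + s ∎
    where
    open TwoPaths g B g B'
    open ≡-Reasoning
    W : ℕ
    W = Σℕ (λ C → δᶜ B C * δᶜ C B')
    e≡0 : e ≡ 0
    e≡0 = inc-own g B'
    #incStay≡0 : #incStay ≡ 0
    #incStay≡0 = +-cancel-0 (trans #incStay-count (trans (cong (d *_) (δᶜ-refl g)) (ℕP.*-zeroʳ d))) e≡0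
    #stayStay≡W : #stayStay ≡ W
    #stayStay≡W = trans #stayStay-count (trans (cong (_* W) (δ-refl g)) (ℕP.*-identityˡ W))

  -- Different points, g on the block B': d(l - 1) incidence-incidence paths,
  -- d - 1 incidence-stay paths and s - 1 stay-incidence paths.
  paths-apart-on : ∀ {g g'} B B' → g ≢ g' → inc g g' B' ≡ 1 →
                   paths (g , B) (g' , B') + 2 ≡ l * d + s
  paths-apart-on {g} {g'} B B' g≢g' e≡1 = begin
    paths (g , B) (g' , B') + 2
      ≡⟨ cong (_+ 2) paths-split ⟩
    #incInc + #incStay + #stayInc + #stayStay + 2
      ≡⟨ cong₂ (λ x y → #incInc + #incStay + x + y + 2) #stayInc≡ (#stayStay-apart g≢g') ⟩
    #incInc + #incStay + Σℕ (δᶜ B) + 0 + 2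
      ≡⟨ solve 3 (λ a b c → a :+ b :+ c :+ con 0 :+ con 2 := a :+ (b :+ con 1) :+ (c :+ con 1))
               refl #incInc #incStay (Σℕ (δᶜ B)) ⟩
    #incInc + (#incStay + 1) + (Σℕ (δᶜ B) + 1)
      ≡⟨ cong₂ (λ x y → #incInc + x + y) #incStay≡ (Σ-others B) ⟩
    #incInc + d + s
      ≡⟨ cong (_+ s) (trans #incInc≡ (ℕP.*-comm d l)) ⟩
    l * d + s ∎
    where
    open TwoPaths g B g' B'
    open ≡-Reasoning
    #incInc≡ : #incInc + d ≡ d * l
    #incInc≡ = trans (cong (#incInc +_) (sym (trans (cong (d *_) e≡1) (ℕP.*-identityʳ d)))) #incInc-count
    #incStay≡ : #incStay + 1 ≡ d
    #incStay≡ = trans (cong (#incStay +_) (sym e≡1))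
      (trans #incStay-count (trans (cong (d *_) (δᶜ-≢ g≢g')) (ℕP.*-identityʳ d)))
    #stayInc≡ : #stayInc ≡ Σℕ (δᶜ B)
    #stayInc≡ = trans #stayInc-count (trans (cong (Σℕ (δᶜ B) *_) e≡1) (ℕP.*-identityʳ (Σℕ (δᶜ B))))

  -- Different points, g not on the block B': d·l incidence-incidence paths
  -- and d incidence-stay paths.
  paths-apart-off : ∀ {g g'} B B' → g ≢ g' → inc g g' B' ≡ 0 →
                    paths (g , B) (g' , B') ≡ (l + 1) * d
  paths-apart-off {g} {g'} B B' g≢g' e≡0 = begin
    paths (g , B) (g' , B')
      ≡⟨ paths-split ⟩
    #incInc + #incStay + #stayInc + #stayStay
      ≡⟨ cong₂ _+_ (cong₂ _+_ (cong₂ _+_ (#incInc-off e≡0) #incStay≡d) (#stayInc-off e≡0))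
                   (#stayStay-apart g≢g') ⟩
    d * l + d + 0 + 0
      ≡⟨ solve 2 (λ d l → d :* l :+ d :+ con 0 :+ con 0 := (l :+ con 1) :* d) refl d l ⟩
    (l + 1) * d ∎
    where
    open TwoPaths g B g' B'
    open ≡-Reasoning
    #incStay≡d : #incStay ≡ d
    #incStay≡d = +-cancel-0 (trans #incStay-count (trans (cong (d *_) (δᶜ-≢ g≢g')) (ℕP.*-identityʳ d))) e≡0

  paths-diagonal : ∀ x → paths x x ≡ l * d + s ∸ 1
  paths-diagonal (g , B) = +-to-∸
    (trans (cong (λ z → paths (g , B) (g , B) + (1 + z)) (sym (δᶜ-refl B))) (paths-same-point g B B))

  -- Off the diagonal, distinguish whether the two vertices share their point
  -- (the decision is passed in so that matching on it leaves arc untouched).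
  paths-arc-by : ∀ g B g' B' → Dec (g ≡ g') → (g , B) ≢ (g' , B') →
                 arc (g , B) (g' , B') ≡ 1 → paths (g , B) (g' , B') ≡ l * d + s ∸ 2
  paths-arc-by g B .g B' (yes refl) x≢y arc≡1 = +-to-∸
    (trans (cong (λ z → paths (g , B) (g , B') + (1 + z)) (sym (δᶜ-≢ (x≢y ∘ cong (g ,_)))))
           (paths-same-point g B B'))
  paths-arc-by g B g' B' (no g≢g') x≢y arc≡1 =
    +-to-∸ (paths-apart-on B B' g≢g' (trans (sym (arc-other-point B B' g≢g')) arc≡1))

  paths-nonarc-by : ∀ g B g' B' → Dec (g ≡ g') → (g , B) ≢ (g' , B') →
                    arc (g , B) (g' , B') ≡ 0 → paths (g , B) (g' , B') ≡ (l + 1) * d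
  paths-nonarc-by g B .g B' (yes refl) x≢y arc≡0 =
    ⊥-elim (1≢0 (trans (sym (δᶜ-≢ (x≢y ∘ cong (g ,_)))) (trans (sym (arc-same-point g B B')) arc≡0)))
    where
    1≢0 : 1 ≢ 0
    1≢0 ()
  paths-nonarc-by g B g' B' (no g≢g') x≢y arc≡0 =
    paths-apart-off B B' g≢g' (trans (sym (arc-other-point B B' g≢g')) arc≡0)

  paths-arc : ∀ x y → x ≢ y → arc x y ≡ 1 → paths x y ≡ l * d + s ∸ 2
  paths-arc (g , B) (g' , B') = paths-arc-by g B g' B' (g ≟ g')

  paths-nonarc : ∀ x y → x ≢ y → arc x y ≡ 0 → paths x y ≡ (l + 1) * d
  paths-nonarc (g , B) (g' , B') = paths-nonarc-by g B g' B' (g ≟ g')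

-- Vertices of D₂ are numbered by remQuot; D₂-adj is the integer matrix of
-- arc on these numbers, and all row, column and 2-path sums become sums over
-- pairs (Σ-remQuot), computed above.
mainTheorem7 : (n d l s : ℕ) → n ≥ 1 → d ≥ 1 → l ≥ 1 → s ≥ 1 →
    d * (n ∸ 1) ≡ l * s →
    (𝓑 : Fin n → Fin s → Subset n) →
    (∀ i → IsTacticalConfiguration (∁ ⁅ i ⁆) (𝓑 i) (n ∸ 1) l d) →
    IsDSRG (n * s) (l * s + s ∸ 1) (l * d + s ∸ 1) (l * d + s ∸ 2) ((l + 1) * d)
      (D₂-adj 𝓑)
mainTheorem7 n d l s _ _ _ _ counts 𝓑 tc =
  dsrg-criterion (D₂-adj 𝓑) a (λ i j → χ-pos (D₂-arc? 𝓑 (vertex i) (vertex j))) _ _ _ _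
    (λ i j → χ-01 (D₂-arc? 𝓑 (vertex i) (vertex j)))
    (λ i → arc-loop (vertex i))
    (λ i → trans (Σ-remQuot n s (arc (vertex i))) (out-degree counts (vertex i)))
    (λ j → trans (Σ-remQuot n s (λ x → arc x (vertex j))) (in-degree (vertex j)))
    (λ i → trans (two-paths i i) (paths-diagonal (vertex i)))
    (λ i j i≢j → trans (two-paths i j) ∘ paths-arc (vertex i) (vertex j) (i≢j ∘ vertex-injective i j))
    (λ i j i≢j → trans (two-paths i j) ∘ paths-nonarc (vertex i) (vertex j) (i≢j ∘ vertex-injective i j))
  where
  open D₂Counting n d l s 𝓑 tc

  vertex : Fin (n * s) → Vertex
  vertex = remQuot s

  vertex-injective : ∀ i j → vertex i ≡ vertex j → i ≡ j
  vertex-injective = remQuot-injective n s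

  a : Fin (n * s) → Fin (n * s) → ℕ
  a i j = arc (vertex i) (vertex j)

  two-paths : ∀ i j → Σℕ (λ z → a i z * a z j) ≡ paths (vertex i) (vertex j)
  two-paths i j = Σ-remQuot n s (λ z → arc (vertex i) z * arc z (vertex j))
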